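{- Let $D$ be the set of Dyck numbers. Let $n\ge 6$ be even, let $j\in\{0,1,2,3\}$, and let $t\in D$ with $$2^{n-1}-1+j\cdot 2^{n-3}<t\le 2^{n-1}-1+(j+1)\cdot 2^{n-3}$$ (the $(j+1)$-th of the four equal segments of the level of binary length $n$). Then $4t-1,\ 4t+1,\ 4t+3$ all belong to $D$, and they lie in the corresponding segment of the level of binary length $n+2$: $$2^{n+1}-1+j\cdot 2^{n-1}<4t-1<4t+1<4t+3\le 2^{n+1}-1+(j+1)\cdot 2^{n-1}.$$
   Context: A Dyck number is a nonnegative integer $t$ such that every suffix of the binary representation of $t$ (i.e. every block of least significant bits) contains at least as many 1's as 0's; these form OEIS A036991: $0,1,3,5,7,11,13,15,19,21,\dots$. -}

module Defs where

open import Data.Nat using (ℕ; zero; suc; _+_; _≤_; _%_; _/_)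
open import Data.Bool using (Bool; true; false)
open import Data.List using (List; []; _∷_; take; length)

-- binary digits of t, least significant first, no leading zeros
-- (fuel-based; fuel t suffices since t halves each step)
bitsAux : ℕ → ℕ → List Bool
bitsAux zero    _ = []
bitsAux (suc f) zero = []
bitsAux (suc f) t@(suc _) with t % 2
... | zero = false ∷ bitsAux f (t / 2)
... | suc _ = true ∷ bitsAux f (t / 2)

bits : ℕ → List Bool
bits t = bitsAux t t

ones : List Bool → ℕ
ones [] = 0
ones (true ∷ bs) = suc (ones bs)
ones (false ∷ bs) = ones bs

zeros : List Bool → ℕ
zeros [] = 0
zeros (true ∷ bs) = zeros bs
zeros (false ∷ bs) = suc (zeros bs)

Dyck : ℕ → Set
Dyck t = ∀ k → k ≤ length (bits t) → zeros (take k (bits t)) ≤ ones (take k (bits t))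

-- A Dyck number t > 0 is odd, t = 2s + 1. Read least significant bit first, the
-- binary word of 4t + 1 is 10 followed by the word of t, that of 4t + 3 is 11
-- followed by it, and that of 4t − 1 = 8s + 3 is 110 followed by the word of s;
-- in each case every prefix still has at least as many 1's as 0's. The
-- segment bounds scale by 4, and the lower one stays strict because the lower
-- end of a segment is even while t is odd.
module Submission where

open import Defs
open import Data.Nat using (ℕ; _+_; _*_; _∸_; _^_; _≤_; _<_; _≥_)
open import Data.Nat.Divisibility using (_∣_)
open import Data.Product using (_×_)
open import Data.Bool using (Bool; true; false)
open import Data.Empty using (⊥-elim)
open import Data.List using (List; []; _∷_; take; length)
open import Data.List.Properties using (take-all)
open import Data.Nat using (zero; suc; _%_; _/_; z≤n; s≤s; s≤s⁻¹; z<s; s<s⁻¹)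
open import Data.Nat.Divisibility using (divides-refl; m∣m*n; ∣n⇒∣m*n; ∣m∣n⇒∣m+n)
open import Data.Nat.DivMod using (m/n<m; m*n/n≡m; m≡m%n+[m/n]*n; m%n<n; [m+kn]%n≡m%n; +-distrib-/-∣ʳ)
open import Data.Nat.Properties
open import Data.Nat.Tactic.RingSolver using (solve-∀)
open import Data.Product using (_,_; ∃-syntax)
open import Relation.Binary.PropositionalEquality
open import Relation.Nullary using (¬_; yes; no)

-- Dyck t is Ballot 0 (bits t); the allowance d absorbs the 1's added or removed
-- at the least significant end.
Ballot : ℕ → List Bool → Set
Ballot d bs = ∀ k → zeros (take k bs) ≤ d + ones (take k bs)

Ballot-[] : ∀ {d} → Ballot d []
Ballot-[] zero = z≤n
Ballot-[] (suc _) = z≤n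

Ballot-mono : ∀ {d e bs} → d ≤ e → Ballot d bs → Ballot e bs
Ballot-mono d≤e ballot k = ≤-trans (ballot k) (+-monoˡ-≤ _ d≤e)

Ballot-true : ∀ {d bs} → Ballot (suc d) bs → Ballot d (true ∷ bs)
Ballot-true ballot zero = z≤n
Ballot-true {d} {bs} ballot (suc k) =
  subst (zeros (take k bs) ≤_) (sym (+-suc d (ones (take k bs)))) (ballot k)

Ballot-true⁻¹ : ∀ {d bs} → Ballot d (true ∷ bs) → Ballot (suc d) bs
Ballot-true⁻¹ {d} {bs} ballot k =
  subst (zeros (take k bs) ≤_) (+-suc d (ones (take k bs))) (ballot (suc k))

Ballot-false : ∀ {d bs} → Ballot d bs → Ballot (suc d) (false ∷ bs)
Ballot-false ballot zero = z≤n
Ballot-false ballot (suc k) = s≤s (ballot k)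

¬Ballot0-false : ∀ {bs} → ¬ Ballot 0 (false ∷ bs)
¬Ballot0-false ballot with ballot 1
... | ()

Dyck⇒Ballot : ∀ t → Dyck t → Ballot 0 (bits t)
Dyck⇒Ballot t dyck k with k ≤? length (bits t)
... | yes k≤len = dyck k k≤len
... | no k≰len rewrite take-all k (bits t) (≰⇒≥ k≰len) =
  subst (λ bs → zeros bs ≤ ones bs) (take-all (length (bits t)) (bits t) ≤-refl)
        (dyck (length (bits t)) ≤-refl)

Ballot⇒Dyck : ∀ t → Ballot 0 (bits t) → Dyck t
Ballot⇒Dyck t ballot k _ = ballot k

bit : ℕ → Bool
bit zero = false
bit (suc _) = true

bitsAux-suc : ∀ f t → bitsAux (suc f) (suc t) ≡ bit (suc t % 2) ∷ bitsAux f (suc t / 2)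
bitsAux-suc f t with suc t % 2
... | zero = refl
... | suc _ = refl

bitsAux-fuel : ∀ {f g t} → t ≤ f → t ≤ g → bitsAux f t ≡ bitsAux g t
bitsAux-fuel {zero} {zero} {zero} _ _ = refl
bitsAux-fuel {zero} {suc _} {zero} _ _ = refl
bitsAux-fuel {suc _} {zero} {zero} _ _ = refl
bitsAux-fuel {suc _} {suc _} {zero} _ _ = refl
bitsAux-fuel {suc f} {suc g} {suc t} (s≤s t≤f) (s≤s t≤g) = begin
  bitsAux (suc f) (suc t)                     ≡⟨ bitsAux-suc f t ⟩
  bit (suc t % 2) ∷ bitsAux f (suc t / 2)     ≡⟨ cong (bit (suc t % 2) ∷_) (bitsAux-fuel (half≤ t≤f) (half≤ t≤g)) ⟩
  bit (suc t % 2) ∷ bitsAux g (suc t / 2)     ≡⟨ sym (bitsAux-suc g t) ⟩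
  bitsAux (suc g) (suc t)                     ∎
  where
  open ≡-Reasoning
  half≤ : ∀ {h} → t ≤ h → suc t / 2 ≤ h
  half≤ t≤h = s≤s⁻¹ (≤-trans (m/n<m (suc t) 2 (s≤s (s≤s z≤n))) (s≤s t≤h))

bits-suc : ∀ t → bits (suc t) ≡ bit (suc t % 2) ∷ bits (suc t / 2)
bits-suc t = trans (bitsAux-suc t t)
  (cong (bit (suc t % 2) ∷_) (bitsAux-fuel (s≤s⁻¹ (m/n<m (suc t) 2 (s≤s (s≤s z≤n)))) ≤-refl))

bits-1+2* : ∀ m → bits (1 + m * 2) ≡ true ∷ bits m
bits-1+2* m = trans (bits-suc (m * 2)) (cong₂ _∷_ (cong bit ([m+kn]%n≡m%n 1 m 2)) (cong bits half))
  where
  half : (1 + m * 2) / 2 ≡ m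
  half = trans (+-distrib-/-∣ʳ 1 {d = 2} (divides-refl m)) (m*n/n≡m m 2)

bits-2*suc : ∀ m → bits (suc m * 2) ≡ false ∷ bits (suc m)
bits-2*suc m = trans (bits-suc (suc (m * 2)))
  (cong₂ _∷_ (cong bit ([m+kn]%n≡m%n 0 (suc m) 2)) (cong bits (m*n/n≡m (suc m) 2)))

Ballot-1+2* : ∀ {d} m → Ballot (suc d) (bits m) → Ballot d (bits (1 + m * 2))
Ballot-1+2* m ballot rewrite bits-1+2* m = Ballot-true ballot

Ballot-1+2*⁻¹ : ∀ {d} m → Ballot d (bits (1 + m * 2)) → Ballot (suc d) (bits m)
Ballot-1+2*⁻¹ m ballot rewrite bits-1+2* m = Ballot-true⁻¹ ballot

Ballot-2* : ∀ {d} m → Ballot d (bits m) → Ballot (suc d) (bits (m * 2))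
Ballot-2* zero _ = Ballot-[]
Ballot-2* (suc m) ballot rewrite bits-2*suc m = Ballot-false ballot

¬Dyck-2*suc : ∀ m → ¬ Dyck (suc m * 2)
¬Dyck-2*suc m dyck = ¬Ballot0-false (subst (Ballot 0) (bits-2*suc m) (Dyck⇒Ballot _ dyck))

Dyck⇒odd : ∀ t → Dyck t → 0 < t → ∃[ s ] t ≡ 1 + s * 2
Dyck⇒odd t dyck t>0 with t % 2 | t / 2 | m≡m%n+[m/n]*n t 2 | m%n<n t 2
... | 1 | s | t≡ | _ = s , t≡
... | 0 | zero | refl | _ = ⊥-elim (<-irrefl refl t>0)
... | 0 | suc s | refl | _ = ⊥-elim (¬Dyck-2*suc s dyck)
... | suc (suc _) | _ | _ | s≤s (s≤s ())

Dyck-4*+1 : ∀ t → Dyck t → Dyck (4 * t + 1)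
Dyck-4*+1 t dyck = subst Dyck (sym (ring t)) (Ballot⇒Dyck _
  (Ballot-1+2* (t * 2) (Ballot-2* t (Dyck⇒Ballot t dyck))))
  where
  ring : ∀ t → 4 * t + 1 ≡ 1 + t * 2 * 2
  ring = solve-∀

Dyck-4*+3 : ∀ t → Dyck t → Dyck (4 * t + 3)
Dyck-4*+3 t dyck = subst Dyck (sym (ring t)) (Ballot⇒Dyck _
  (Ballot-1+2* (1 + t * 2) (Ballot-1+2* t (Ballot-mono z≤n (Dyck⇒Ballot t dyck)))))
  where
  ring : ∀ t → 4 * t + 3 ≡ 1 + (1 + t * 2) * 2
  ring = solve-∀

4*suc∸1≡4*+3 : ∀ m → 4 * suc m ∸ 1 ≡ 4 * m + 3
4*suc∸1≡4*+3 m = reduced m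
  where
  -- the ring solver does not handle ∸, so the left side is given in normal form
  reduced : ∀ m → m + 3 * suc m ≡ 4 * m + 3
  reduced = solve-∀

Dyck-4*∸1 : ∀ t → Dyck t → Dyck (4 * t ∸ 1)
Dyck-4*∸1 zero dyck = dyck
Dyck-4*∸1 t@(suc _) dyck with Dyck⇒odd t dyck z<s
... | s , refl = subst Dyck (sym (trans (4*suc∸1≡4*+3 (s * 2)) (ring s))) (Ballot⇒Dyck _
  (Ballot-1+2* (1 + s * 2 * 2) (Ballot-1+2* (s * 2) (Ballot-2* s
    (Ballot-1+2*⁻¹ s (Dyck⇒Ballot t dyck))))))
  where
  ring : ∀ s → 4 * (s * 2) + 3 ≡ 1 + (1 + s * 2 * 2) * 2
  ring = solve-∀

even<odd : ∀ {a s} → 2 ∣ a → a ≤ 1 + s * 2 → a < 1 + s * 2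
even<odd {s = s} (divides-refl q) a≤t = ≤∧≢⇒< a≤t λ q*2≡1+s*2 →
  even≢odd q s (trans (*-comm 2 q) (trans q*2≡1+s*2 (cong suc (*-comm s 2))))

[4c∸1]+k[4w]≡4[[c∸1]+kw]+3 : ∀ c w k → 0 < c →
  (4 * c ∸ 1) + k * (4 * w) ≡ 4 * ((c ∸ 1) + k * w) + 3
[4c∸1]+k[4w]≡4[[c∸1]+kw]+3 (suc c) w k _ =
  trans (cong (_+ k * (4 * w)) (4*suc∸1≡4*+3 c)) (ring c w k)
  where
  ring : ∀ c w k → 4 * c + 3 + k * (4 * w) ≡ 4 * (c + k * w) + 3
  ring = solve-∀

segment-lower-×4 : ∀ c w j t → 0 < c → 2 ∣ c + j * w → ∃[ s ] t ≡ 1 + s * 2 →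
  (c ∸ 1) + j * w < t → (4 * c ∸ 1) + j * (4 * w) < 4 * t ∸ 1
segment-lower-×4 c@(suc _) w j _ c>0 even (s , refl) lo<t =
  subst₂ _<_ (sym ([4c∸1]+k[4w]≡4[[c∸1]+kw]+3 c w j c>0)) (sym (4*suc∸1≡4*+3 (s * 2)))
    (+-monoˡ-< 3 (*-monoʳ-< 4 (s<s⁻¹ (even<odd {s = s} even lo<t))))

segment-upper-×4 : ∀ c w k t → 0 < c →
  t ≤ (c ∸ 1) + k * w → 4 * t + 3 ≤ (4 * c ∸ 1) + k * (4 * w)
segment-upper-×4 c w k t c>0 t≤hi =
  subst (4 * t + 3 ≤_) (sym ([4c∸1]+k[4w]≡4[[c∸1]+kw]+3 c w k c>0))
    (+-monoˡ-≤ 3 (*-monoʳ-≤ 4 t≤hi))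

4*2^m≡2^[2+m] : ∀ m → 4 * 2 ^ m ≡ 2 ^ (2 + m)
4*2^m≡2^[2+m] m = *-assoc 2 2 (2 ^ m)

proposition12 : (n j t : ℕ) → n ≥ 6 → 2 ∣ n → j ≤ 3 → Dyck t
    → (2 ^ (n ∸ 1) ∸ 1) + j * 2 ^ (n ∸ 3) < t
    → t ≤ (2 ^ (n ∸ 1) ∸ 1) + (j + 1) * 2 ^ (n ∸ 3)
    → (Dyck (4 * t ∸ 1) × Dyck (4 * t + 1) × Dyck (4 * t + 3))
      × ((2 ^ (n + 1) ∸ 1) + j * 2 ^ (n ∸ 1) < 4 * t ∸ 1)
      × (4 * t ∸ 1 < 4 * t + 1)
      × (4 * t + 1 < 4 * t + 3)
      × (4 * t + 3 ≤ (2 ^ (n + 1) ∸ 1) + (j + 1) * 2 ^ (n ∸ 1))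
proposition12 n@(suc (suc (suc (suc k)))) j t (s≤s (s≤s (s≤s (s≤s _)))) _ _ dyck lo<t t≤hi =
    (Dyck-4*∸1 t dyck , Dyck-4*+1 t dyck , Dyck-4*+3 t dyck)
  , subst₂ (λ C W → (C ∸ 1) + j * W < 4 * t ∸ 1) 4c≡ 4w≡
      (segment-lower-×4 c w j t c>0 lower-end-even (Dyck⇒odd t dyck t>0) lo<t)
  , ≤-<-trans (m∸n≤m (4 * t) 1) (m<m+n (4 * t) z<s)
  , +-monoʳ-< (4 * t) (s≤s (s≤s z≤n))
  , subst₂ (λ C W → 4 * t + 3 ≤ (C ∸ 1) + (j + 1) * W) 4c≡ 4w≡
      (segment-upper-×4 c w (j + 1) t c>0 t≤hi)
  where
  c w : ℕ
  c = 2 ^ (n ∸ 1)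
  w = 2 ^ suc k
  c>0 : 0 < c
  c>0 = m^n>0 2 (n ∸ 1)
  t>0 : 0 < t
  t>0 = ≤-trans z<s lo<t
  lower-end-even : 2 ∣ c + j * w
  lower-end-even = ∣m∣n⇒∣m+n (m∣m*n (2 ^ (2 + k))) (∣n⇒∣m*n j (m∣m*n (2 ^ k)))
  4c≡ : 4 * c ≡ 2 ^ (n + 1)
  4c≡ = trans (4*2^m≡2^[2+m] (n ∸ 1)) (cong (λ e → 2 ^ suc e) (+-comm 1 (n ∸ 1)))
  4w≡ : 4 * w ≡ c
  4w≡ = 4*2^m≡2^[2+m] (suc k)
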